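{- Let $l\ge2$ and let $C$ be an odd cycle with vertices in cyclic order $v_1,v_2,\ldots,v_{2l+1}$. Let $m$ be a positive integer with $m\le 2l-2$. Construct $G_{l,m,1}$ from $C$ by adding two new vertices $u_1$ and $s_1$, joining $u_1$ to every vertex of $\{v_j: 1\le j\le 2+m\}$ and joining $s_1$ to every vertex of $V(C)\setminus\{v_1,v_2\}$. Then $G_{l,m,1}$ is strong $4$-chromatic-choosable whenever $m\le 4$.
   Context: A list assignment gives each vertex a color set; a $k$-assignment has all lists of size $k$; $G$ is $L$-colorable if it has a proper coloring choosing each vertex's color from its list. A list assignment is constant if all lists are equal. $G$ is strong $k$-chromatic-choosable if $\chi(G)=k$ and every $(k-1)$-assignment $L$ for which $G$ is not $L$-colorable is constant. -}

module Defs where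

open import Data.Nat using (ℕ; zero; suc; _+_; _*_; _∸_; _≤_; _<_)
open import Data.Fin using (Fin; toℕ)
open import Data.List using (List; length)
open import Data.List.Membership.Propositional using (_∈_)
open import Data.List.Relation.Unary.Unique.Propositional using (Unique)
open import Data.Product using (Σ; _×_; ∃)
open import Data.Sum using (_⊎_)
open import Relation.Binary.PropositionalEquality using (_≡_; _≢_)
open import Relation.Nullary using (¬_)

record Graph : Set₁ where
  field
    size : ℕ
    Adj  : Fin size → Fin size → Set

open Graph public

Colorable : Graph → ℕ → Set
Colorable G k = Σ (Fin (size G) → Fin k) λ f →
  ∀ x y → Adj G x y → f x ≢ f y

ChromaticNumberIs : Graph → ℕ → Set
ChromaticNumberIs G k = Colorable G k × (∀ j → Colorable G j → k ≤ j)

ListAssignment : Graph → Set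
ListAssignment G = Fin (size G) → List ℕ

IsKAssignment : (G : Graph) → ℕ → ListAssignment G → Set
IsKAssignment G k L = ∀ x → Unique (L x) × length (L x) ≡ k

LColorable : (G : Graph) → ListAssignment G → Set
LColorable G L = Σ (Fin (size G) → ℕ) λ f →
  (∀ x → f x ∈ L x) × (∀ x y → Adj G x y → f x ≢ f y)

IsConstant : (G : Graph) → ListAssignment G → Set
IsConstant G L = ∀ x y (c : ℕ) → c ∈ L x → c ∈ L y

StrongChromaticChoosable : Graph → ℕ → Set
StrongChromaticChoosable G k =
  ChromaticNumberIs G k ×
  (∀ (L : ListAssignment G) → IsKAssignment G (k ∸ 1) L →
     ¬ LColorable G L → IsConstant G L)

-- Vertex indices: i (0 ≤ i ≤ 2l) is v_{i+1};
-- index 2l+1 is u_1; index 2l+2 is s_1.  Here n = 2l+1 = |V(C)|.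
data Edge (l m : ℕ) : ℕ → ℕ → Set where
  cyc   : ∀ {i} → suc i < 2 * l + 1 → Edge l m i (suc i)
  close : Edge l m 0 (2 * l)
  -- u_1 joined to v_j for 1 ≤ j ≤ 2+m (indices j-1 < m+2)
  uEdge : ∀ {j} → j < m + 2 → j < 2 * l + 1 → Edge l m (2 * l + 1) j
  -- s_1 joined to V(C) \ {v_1, v_2} (indices 2 ≤ j ≤ 2l)
  sEdge : ∀ {j} → 2 ≤ j → j < 2 * l + 1 → Edge l m (2 * l + 2) j

G-lm1 : ℕ → ℕ → Graph
G-lm1 l m = record
  { size = 2 * l + 3
  ; Adj  = λ x y → Edge l m (toℕ x) (toℕ y) ⊎ Edge l m (toℕ y) (toℕ x)
  }

module Submission where

-- In a 3-colouring of G the path v₃ … v₂ₗ₊₁, all of whose vertices see s,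
-- alternates between the two colours other than that of s, so v₃ and v₂ₗ₊₁ agree;
-- then v₁ and v₂ take the colour of s and that of v₄, and u, adjacent to v₁, v₂,
-- v₃, needs a fourth colour.
--
-- Let L be a 3-assignment without L-colouring and give u and s colours from their
-- lists. If every vertex of C keeps two admissible colours, then all admissible
-- sets are one and the same pair {b₁, b₂}, for otherwise some edge lets a greedy
-- colouring of C close up. If L(u) and L(s) share a colour a, give it to both
-- hubs: a colour of L(u) outside {a, b₁, b₂} could replace a at u and would leave
-- three admissible colours at v₂ (likewise at v₂ₗ₊₁ for s, as m ≤ 2l − 2), so
-- every list is {a, b₁, b₂}. If L(u) and L(s) are disjoint, double counting (a
-- 3-list contains at most two of the nine pairs in L(u) × L(s), and u and s have
-- m ≤ 4 common neighbours) gives x ∈ L(u), y ∈ L(s) lying together in no common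
-- neighbour's list; with u, s coloured x, y the same recolouring argument puts
-- b₁ into both L(u) and L(s).

open import Algebra.Properties.CommutativeSemigroup using (interchange)
open import Data.Empty using (⊥; ⊥-elim)
open import Data.Fin using (Fin; toℕ; fromℕ<) renaming (zero to 0F; suc to sucF)
open import Data.Fin.Properties using (toℕ<n; fromℕ<-toℕ; toℕ-fromℕ<; pigeonhole)
  renaming (_≟_ to _≟F_)
open import Data.List using (List; []; _∷_; _++_; [_]; length; map; upTo)
open import Data.List.Properties using (map-++; map-cong; length-map; length-upTo)
open import Data.List.Membership.Propositional using (_∈_; _∉_; find)
open import Data.List.Membership.Propositional.Properties using (∈-map⁺; ∈-upTo⁺)
open import Data.List.Relation.Binary.Disjoint.Propositional using (Disjoint)
open import Data.List.Relation.Unary.All using (All; []; _∷_; all?)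
import Data.List.Relation.Unary.All as All
open import Data.List.Relation.Unary.All.Properties using (¬Any⇒All¬; ¬All⇒Any¬)
  renaming (map⁺ to All-map⁺)
open import Data.List.Relation.Unary.AllPairs using ([]; _∷_)
open import Data.List.Relation.Unary.Any using (Any; here; there; any?)
import Data.List.Relation.Unary.Any as Any
open import Data.List.Relation.Unary.Unique.Propositional using (Unique)
open import Data.List.Relation.Unary.Unique.Propositional.Properties using (++⁺)
open import Data.Nat using (ℕ; zero; suc; _+_; _*_; _∸_; _≤_; _<_; z≤n; s≤s; _≟_; _≤?_; _<?_)
open import Data.List.Membership.DecPropositional _≟_ using (_∈?_)
open import Data.Nat.ListAction using (sum)
open import Data.Nat.ListAction.Properties using (sum-++)
open import Data.Nat.Properties
open import Data.Product using (Σ; ∃₂; _×_; _,_; proj₁; proj₂)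
open import Data.Sum using (_⊎_; inj₁; inj₂; [_,_]′; swap; assocʳ)
open import Data.Vec using (Vec; []; _∷_; lookup)
open import Data.Vec.Relation.Unary.All using ([]; _∷_)
open import Data.Vec.Relation.Unary.AllPairs using ([]; _∷_)
open import Data.Vec.Relation.Unary.Unique.Propositional using () renaming (Unique to UniqueVec)
open import Data.Vec.Relation.Unary.Unique.Propositional.Properties using (lookup-injective)
open import Function using (_∘_; id)
open import Relation.Binary using (tri<; tri≈; tri>)
open import Relation.Binary.PropositionalEquality
  using (_≡_; _≢_; refl; sym; trans; cong; cong₂; subst; subst₂; module ≡-Reasoning)
open import Relation.Nullary using (¬_; Dec; yes; no)
open import Relation.Nullary.Decidable using (_×-dec_; ¬?; decidable-stable)

open import Defs

private
  variable
    A : Set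
    P Q : ℕ → Set
    a b c x y : ℕ
    xs : List ℕ
    Zs : List (List ℕ)

AtLeastTwo : (ℕ → Set) → Set
AtLeastTwo P = Σ ℕ λ d → Σ ℕ λ e → d ≢ e × P d × P e

AtLeastThree : (ℕ → Set) → Set
AtLeastThree P = Σ ℕ λ d → Σ ℕ λ e → Σ ℕ λ f →
  d ≢ e × d ≢ f × e ≢ f × P d × P e × P f

AtLeastTwo-map : (∀ {x} → P x → Q x) → AtLeastTwo P → AtLeastTwo Q
AtLeastTwo-map g (d , e , d≢e , pd , pe) = d , e , d≢e , g pd , g pe

AtLeastThree-map : (∀ {x} → P x → Q x) → AtLeastThree P → AtLeastThree Q
AtLeastThree-map g (d , e , f , d≢e , d≢f , e≢f , pd , pe , pf) =
  d , e , f , d≢e , d≢f , e≢f , g pd , g pe , g pf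

pick-avoiding : AtLeastTwo P → ∀ c → Σ ℕ λ x → P x × x ≢ c
pick-avoiding (d , e , d≢e , pd , pe) c with d ≟ c
... | no d≢c   = d , pd , d≢c
... | yes refl = e , pe , d≢e ∘ sym

three⇒two-avoiding : AtLeastThree P → ∀ c → AtLeastTwo (λ x → P x × x ≢ c)
three⇒two-avoiding (d , e , f , d≢e , d≢f , e≢f , pd , pe , pf) c with d ≟ c | e ≟ c
... | yes refl | _        = e , f , e≢f , (pe , d≢e ∘ sym) , (pf , d≢f ∘ sym)
... | no d≢c   | yes refl = d , f , d≢f , (pd , d≢c) , (pf , e≢f ∘ sym)
... | no d≢c   | no e≢c   = d , e , d≢e , (pd , d≢c) , (pe , e≢c)

three⇏two : AtLeastThree P → ¬ (∀ {x} → P x → x ≡ a ⊎ x ≡ b)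
three⇏two (d , e , f , d≢e , d≢f , e≢f , pd , pe , pf) two with two pd | two pe | two pf
... | inj₁ refl | inj₁ refl | _         = d≢e refl
... | inj₁ refl | inj₂ refl | inj₁ refl = d≢f refl
... | inj₁ refl | inj₂ refl | inj₂ refl = e≢f refl
... | inj₂ refl | inj₁ refl | inj₁ refl = e≢f refl
... | inj₂ refl | inj₁ refl | inj₂ refl = d≢f refl
... | inj₂ refl | inj₂ refl | _         = d≢e refl

triple⇒three : Unique xs → length xs ≡ 3 → AtLeastThree (_∈ xs)
triple⇒three {d ∷ e ∷ f ∷ []} ((d≢e ∷ d≢f ∷ []) ∷ (e≢f ∷ []) ∷ _) refl =
  d , e , f , d≢e , d≢f , e≢f , here refl , there (here refl) , there (there (here refl))

within-triple⇒first∈ : AtLeastThree (_∈ xs) →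
  (∀ {x} → x ∈ xs → x ≡ a ⊎ x ≡ b ⊎ x ≡ c) → a ∈ xs
within-triple⇒first∈ {xs} {a} three within with a ∈? xs
... | yes a∈xs = a∈xs
... | no a∉xs  = ⊥-elim (three⇏two three λ x∈xs →
      [ (λ { refl → ⊥-elim (a∉xs x∈xs) }) , id ]′ (within x∈xs))

within-triple⇒all∈ : AtLeastThree (_∈ xs) →
  (∀ {x} → x ∈ xs → x ≡ a ⊎ x ≡ b ⊎ x ≡ c) → a ∈ xs × b ∈ xs × c ∈ xs
within-triple⇒all∈ three within =
  within-triple⇒first∈ three within ,
  within-triple⇒first∈ three (rotate ∘ within) ,
  within-triple⇒first∈ three (rotate ∘ rotate ∘ within)
  where
  rotate : ∀ {B C D : Set} → B ⊎ C ⊎ D → C ⊎ D ⊎ B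
  rotate = assocʳ ∘ swap

-- Lists of two colours on a cycle

splice : ℕ → (ℕ → A) → (ℕ → A) → ℕ → A
splice j f g i with i ≤? j
... | yes _ = f i
... | no  _ = g i

module _ {j : ℕ} (f g : ℕ → A) where

  splice-≤ : ∀ {i} → i ≤ j → splice j f g i ≡ f i
  splice-≤ {i} i≤j with i ≤? j
  ... | yes _  = refl
  ... | no i≰j = ⊥-elim (i≰j i≤j)

  splice-> : ∀ {i} → j < i → splice j f g i ≡ g i
  splice-> {i} j<i with i ≤? j
  ... | yes i≤j = ⊥-elim (<⇒≱ j<i i≤j)
  ... | no _    = refl

≢-transport : {a b a′ b′ : A} → a ≡ a′ → b ≡ b′ → a′ ≢ b′ → a ≢ b
≢-transport refl refl a≢b = a≢b

record PathColouring (ok : ℕ → ℕ → Set) (lo hi : ℕ) : Set where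
  field
    colour     : ℕ → ℕ
    admissible : ∀ {i} → lo ≤ i → i ≤ hi → ok i (colour i)
    proper     : ∀ {i} → lo ≤ i → i < hi → colour i ≢ colour (suc i)

open PathColouring

CycleColouring : (ℕ → ℕ → Set) → ℕ → Set
CycleColouring ok N = Σ (PathColouring ok 0 N) λ h → colour h 0 ≢ colour h N

SplitEdge : (ℕ → ℕ → Set) → ℕ → Set
SplitEdge ok j = Σ ℕ λ c → ok j c × AtLeastTwo (λ d → ok (suc j) d × d ≢ c)

module _ {ok : ℕ → ℕ → Set} where

  single-vertex-path : ∀ {v c} → ok v c → PathColouring ok v v
  single-vertex-path {c = c} okc = record
    { colour     = λ _ → c
    ; admissible = λ v≤i i≤v → subst (λ i → ok i c) (≤-antisym v≤i i≤v) okc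
    ; proper     = λ v≤i i<v → ⊥-elim (<⇒≱ i<v v≤i)
    }

  extend-path : ∀ {lo hi c} (h : PathColouring ok lo hi) →
    ok (suc hi) c → colour h hi ≢ c →
    Σ (PathColouring ok lo (suc hi)) λ h′ → colour h′ (suc hi) ≡ c
  extend-path {lo} {hi} {c} h okc last≢c =
    record { colour = col ; admissible = admissible′ ; proper = proper′ } ,
    splice-> (colour h) _ (n<1+n hi)
    where
    col = splice hi (colour h) (λ _ → c)
    admissible′ : ∀ {i} → lo ≤ i → i ≤ suc hi → ok i (col i)
    admissible′ {i} lo≤i i≤1+hi with i ≤? hi
    ... | yes i≤hi = admissible h lo≤i i≤hi
    ... | no i≰hi  = subst (λ k → ok k c) (≤-antisym (≰⇒> i≰hi) i≤1+hi) okc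
    proper′ : ∀ {i} → lo ≤ i → i < suc hi → col i ≢ col (suc i)
    proper′ {i} lo≤i (s≤s i≤hi) with m≤n⇒m<n∨m≡n i≤hi
    ... | inj₁ i<hi = ≢-transport (splice-≤ (colour h) _ i≤hi) (splice-≤ (colour h) _ i<hi)
                        (proper h lo≤i i<hi)
    ... | inj₂ refl = ≢-transport (splice-≤ (colour h) _ i≤hi) (splice-> (colour h) _ (n<1+n hi))
                        last≢c

  path-ending-in : ∀ {lo} hi {c} → lo ≤ hi → ok hi c →
    (∀ {i} → lo ≤ i → i < hi → AtLeastTwo (ok i)) →
    Σ (PathColouring ok lo hi) λ h → colour h hi ≡ c
  path-ending-in zero z≤n okc two = single-vertex-path okc , refl
  path-ending-in {lo} (suc hi) {c} lo≤1+hi okc two with lo ≟ suc hi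
  ... | yes refl   = single-vertex-path okc , refl
  ... | no lo≢1+hi =
    let lo≤hi            = ≤-pred (≤∧≢⇒< lo≤1+hi lo≢1+hi)
        c′ , okc′ , c′≢c = pick-avoiding (two lo≤hi ≤-refl) c
        h , h-ends-in-c′ = path-ending-in hi lo≤hi okc′ λ lo≤i i<hi → two lo≤i (m≤n⇒m≤1+n i<hi)
    in extend-path h okc λ eq → c′≢c (trans (sym h-ends-in-c′) eq)

  path-avoiding : ∀ {lo hi} → lo ≤ hi →
    (∀ {i} → lo ≤ i → i ≤ hi → AtLeastTwo (ok i)) → ∀ p →
    Σ (PathColouring ok lo hi) λ h → colour h hi ≢ p
  path-avoiding {hi = hi} lo≤hi two p =
    let c , okc , c≢p   = pick-avoiding (two lo≤hi ≤-refl) p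
        h , h-ends-in-c = path-ending-in hi lo≤hi okc λ lo≤i i<hi → two lo≤i (<⇒≤ i<hi)
    in h , λ eq → c≢p (trans (sym h-ends-in-c) eq)

-- Colour 0, …, j greedily downwards from j, which takes the colour c of the
-- split edge, then j+1, …, N greedily downwards from N, which avoids the colour
-- of vertex 0; vertex j+1 has two colours besides c, so one of them is left.
split-edge⇒cycle-colouring : ∀ {ok N j} → (∀ {i} → i ≤ N → AtLeastTwo (ok i)) → j < N →
  SplitEdge ok j → CycleColouring ok N
split-edge⇒cycle-colouring {ok} {N} {j} two j<N (c , okc , split) =
  record { colour = col ; admissible = admissible′ ; proper = proper′ } , closing
  where
  lower = path-ending-in j z≤n okc λ _ i<j → two (≤-trans (<⇒≤ i<j) (<⇒≤ j<N))
  ok′ : ℕ → ℕ → Set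
  ok′ i x = ok i x × (i ≡ suc j → x ≢ c)
  two′ : ∀ {i} → suc j ≤ i → i ≤ N → AtLeastTwo (ok′ i)
  two′ {i} _ i≤N with i ≟ suc j
  ... | yes refl = AtLeastTwo-map (λ (okx , x≢c) → okx , λ _ → x≢c) split
  ... | no i≢1+j = AtLeastTwo-map (λ okx → okx , λ i≡1+j → ⊥-elim (i≢1+j i≡1+j)) (two i≤N)
  upper = path-avoiding j<N two′ (colour (proj₁ lower) 0)
  col-lower = colour (proj₁ lower)
  col-upper = colour (proj₁ upper)
  col = splice j col-lower col-upper
  admissible′ : ∀ {i} → 0 ≤ i → i ≤ N → ok i (col i)
  admissible′ {i} _ i≤N with i ≤? j
  ... | yes i≤j = admissible (proj₁ lower) z≤n i≤j
  ... | no i≰j  = proj₁ (admissible (proj₁ upper) (≰⇒> i≰j) i≤N)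
  proper′ : ∀ {i} → 0 ≤ i → i < N → col i ≢ col (suc i)
  proper′ {i} _ i<N with <-cmp i j
  ... | tri< i<j _ _  = ≢-transport (splice-≤ col-lower col-upper (<⇒≤ i<j)) (splice-≤ col-lower col-upper i<j)
                          (proper (proj₁ lower) z≤n i<j)
  ... | tri≈ _ refl _ = ≢-transport (splice-≤ col-lower col-upper ≤-refl) (splice-> col-lower col-upper (n<1+n i))
                          λ eq → proj₂ (admissible (proj₁ upper) ≤-refl j<N) refl
                                   (trans (sym eq) (proj₂ lower))
  ... | tri> _ _ j<i  = ≢-transport (splice-> col-lower col-upper j<i) (splice-> col-lower col-upper (m≤n⇒m≤1+n j<i))
                          (proper (proj₁ upper) j<i i<N)
  closing : col 0 ≢ col N
  closing = ≢-transport (splice-≤ {j = j} col-lower col-upper z≤n) (splice-> col-lower col-upper j<N) (proj₂ upper ∘ sym)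

module UncolourableCycle {ok : ℕ → ℕ → Set} {N : ℕ} (1≤N : 1 ≤ N)
  (two : ∀ {i} → i ≤ N → AtLeastTwo (ok i)) (uncolourable : ¬ CycleColouring ok N) where

  admissible-step : ∀ {j c} → j < N → ok j c → ok (suc j) c
  admissible-step {j} {c} j<N okc with two j<N
  ... | d , e , d≢e , okd , oke with d ≟ c | e ≟ c
  ...   | yes refl | _        = okd
  ...   | no _     | yes refl = oke
  ...   | no d≢c   | no e≢c   = ⊥-elim (uncolourable (split-edge⇒cycle-colouring two j<N
          (c , okc , d , e , d≢e , (okd , d≢c) , (oke , e≢c))))

  admissible-mono : ∀ {i k c} → i ≤ k → k ≤ N → ok i c → ok k c
  admissible-mono {k = zero} z≤n _ okc = okc
  admissible-mono {i} {suc k} i≤1+k 1+k≤N okc with i ≟ suc k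
  ... | yes refl = okc
  ... | no i≢1+k = admissible-step 1+k≤N
                     (admissible-mono (≤-pred (≤∧≢⇒< i≤1+k i≢1+k)) (<⇒≤ 1+k≤N) okc)

  -- Three colours admissible at i stay admissible up to the last vertex, where
  -- two of them avoid a colour of its predecessor: a split edge.
  no-three : ∀ {i} → i ≤ N → ¬ AtLeastThree (ok i)
  no-three {i} i≤N three =
    let c , _ , _ , okc , _ = two (<⇒≤ last<N)
        three-last  = AtLeastThree-map (admissible-mono (subst (i ≤_) N≡1+last i≤N) last<N) three
    in uncolourable (split-edge⇒cycle-colouring two last<N
         (c , okc , three⇒two-avoiding three-last c))
    where
    last = N ∸ 1
    N≡1+last : N ≡ suc last
    N≡1+last = sym (m+[n∸m]≡n 1≤N)
    last<N : last < N
    last<N = ≤-reflexive (sym N≡1+last)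

  b₁ b₂ : ℕ
  b₁ = proj₁ (two z≤n)
  b₂ = proj₁ (proj₂ (two z≤n))

  b₁≢b₂ : b₁ ≢ b₂
  b₁≢b₂ = proj₁ (proj₂ (proj₂ (two z≤n)))

  b₁-admissible : ∀ {i} → i ≤ N → ok i b₁
  b₁-admissible i≤N = admissible-mono z≤n i≤N (proj₁ (proj₂ (proj₂ (proj₂ (two z≤n)))))

  b₂-admissible : ∀ {i} → i ≤ N → ok i b₂
  b₂-admissible i≤N = admissible-mono z≤n i≤N (proj₂ (proj₂ (proj₂ (proj₂ (two z≤n)))))

  admissible⇒b₁∨b₂ : ∀ {i x} → i ≤ N → ok i x → x ≡ b₁ ⊎ x ≡ b₂
  admissible⇒b₁∨b₂ {i} {x} i≤N okx with x ≟ b₁ | x ≟ b₂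
  ... | yes x≡b₁ | _        = inj₁ x≡b₁
  ... | no _     | yes x≡b₂ = inj₂ x≡b₂
  ... | no x≢b₁  | no x≢b₂  = ⊥-elim (no-three i≤N
        (x , b₁ , b₂ , x≢b₁ , x≢b₂ , b₁≢b₂ , okx , b₁-admissible i≤N , b₂-admissible i≤N))

-- Double counting

∑ : List A → (A → ℕ) → ℕ
∑ xs f = sum (map f xs)

syntax ∑ xs (λ x → e) = ∑[ x ∈ xs ] e

∑-cong : ∀ (zs : List A) {f g : A → ℕ} → (∀ z → f z ≡ g z) → ∑ zs f ≡ ∑ zs g
∑-cong zs f≗g = cong sum (map-cong f≗g zs)

∑-+ : ∀ (zs : List A) (f g : A → ℕ) → ∑[ z ∈ zs ] (f z + g z) ≡ ∑ zs f + ∑ zs g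
∑-+ []       f g = refl
∑-+ (z ∷ zs) f g =
  trans (cong (f z + g z +_) (∑-+ zs f g)) (interchange +-commutativeSemigroup (f z) (g z) _ _)

∑-*ˡ : ∀ (zs : List A) k (f : A → ℕ) → ∑[ z ∈ zs ] (k * f z) ≡ k * ∑ zs f
∑-*ˡ []       k f = sym (*-zeroʳ k)
∑-*ˡ (z ∷ zs) k f = trans (cong (k * f z +_) (∑-*ˡ zs k f)) (sym (*-distribˡ-+ k (f z) _))

∑-*ʳ : ∀ (zs : List A) k (f : A → ℕ) → ∑[ z ∈ zs ] (f z * k) ≡ ∑ zs f * k
∑-*ʳ zs k f = trans (∑-cong zs λ z → *-comm (f z) k) (trans (∑-*ˡ zs k f) (*-comm k _))

∑-zero : ∀ (zs : List A) → ∑[ z ∈ zs ] 0 ≡ 0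
∑-zero []       = refl
∑-zero (_ ∷ zs) = ∑-zero zs

∑-comm : ∀ {B : Set} (xs : List A) (ys : List B) (f : A → B → ℕ) →
  ∑[ x ∈ xs ] ∑[ y ∈ ys ] f x y ≡ ∑[ y ∈ ys ] ∑[ x ∈ xs ] f x y
∑-comm []       ys f = sym (∑-zero ys)
∑-comm (x ∷ xs) ys f =
  trans (cong (∑ ys (f x) +_) (∑-comm xs ys f)) (sym (∑-+ ys (f x) λ y → ∑[ x ∈ xs ] f x y))

∑-mono : ∀ (zs : List A) {f g : A → ℕ} → (∀ z → f z ≤ g z) → ∑ zs f ≤ ∑ zs g
∑-mono []       f≤g = z≤n
∑-mono (z ∷ zs) f≤g = +-mono-≤ (f≤g z) (∑-mono zs f≤g)

∑-≤ : ∀ {zs : List A} {f : A → ℕ} {k} → All (λ z → f z ≤ k) zs → ∑ zs f ≤ length zs * k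
∑-≤ []            = z≤n
∑-≤ (fz≤k ∷ rest) = +-mono-≤ fz≤k (∑-≤ rest)

∑-≥ : ∀ {zs : List A} {f : A → ℕ} {k} → All (λ z → k ≤ f z) zs → length zs * k ≤ ∑ zs f
∑-≥ []            = z≤n
∑-≥ (k≤fz ∷ rest) = +-mono-≤ k≤fz (∑-≥ rest)

𝟙[_∈_] : ℕ → List ℕ → ℕ
𝟙[ x ∈ Z ] with x ∈? Z
... | yes _ = 1
... | no  _ = 0

𝟙-∈ : ∀ {Z} → x ∈ Z → 𝟙[ x ∈ Z ] ≡ 1
𝟙-∈ {x} {Z} x∈Z with x ∈? Z
... | yes _  = refl
... | no x∉Z = ⊥-elim (x∉Z x∈Z)

𝟙-∉ : ∀ {Z} → x ∉ Z → 𝟙[ x ∈ Z ] ≡ 0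
𝟙-∉ {x} {Z} x∉Z with x ∈? Z
... | yes x∈Z = ⊥-elim (x∉Z x∈Z)
... | no _    = refl

𝟙-∷ : ∀ x p Z → 𝟙[ x ∈ p ∷ Z ] ≤ 𝟙[ x ∈ [ p ] ] + 𝟙[ x ∈ Z ]
𝟙-∷ x p Z with x ∈? p ∷ Z
... | no _            = z≤n
... | yes (here refl) = ≤-trans (≤-reflexive (sym (𝟙-∈ {Z = [ x ]} (here refl)))) (m≤m+n _ _)
... | yes (there x∈Z) = ≤-trans (≤-reflexive (sym (𝟙-∈ x∈Z))) (m≤n+m _ _)

∣_∩_∣ : List ℕ → List ℕ → ℕ
∣ X ∩ Z ∣ = ∑[ x ∈ X ] 𝟙[ x ∈ Z ]

∩-++ : ∀ X Y Z → ∣ X ++ Y ∩ Z ∣ ≡ ∣ X ∩ Z ∣ + ∣ Y ∩ Z ∣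
∩-++ X Y Z = trans (cong sum (map-++ _ X Y)) (sum-++ (map _ X) _)

∩-disjoint : ∀ {X Z} → All (_∉ Z) X → ∣ X ∩ Z ∣ ≡ 0
∩-disjoint []            = refl
∩-disjoint (x∉Z ∷ X∉Z) = trans (cong (_+ _) (𝟙-∉ x∉Z)) (∩-disjoint X∉Z)

∩-singleton : ∀ {X} → Unique X → ∀ p → ∣ X ∩ [ p ] ∣ ≤ 1
∩-singleton {[]}    []             p = z≤n
∩-singleton {x ∷ X} (x∉X ∷ unique) p with x ≟ p
... | yes refl = s≤s (≤-reflexive (∩-disjoint (All.map (λ x≢y y≡x → x≢y (sym (y≡x′ y≡x))) x∉X)))
  where
  y≡x′ : ∀ {y} → y ∈ [ x ] → y ≡ x
  y≡x′ (here y≡x) = y≡x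
... | no _     = ∩-singleton unique p

∩≤length : ∀ {X} → Unique X → ∀ Z → ∣ X ∩ Z ∣ ≤ length Z
∩≤length {X} unique []      = ≤-reflexive (∩-disjoint {Z = []} (All.universal (λ _ ()) X))
∩≤length {X} unique (p ∷ Z) = begin
  ∣ X ∩ p ∷ Z ∣                             ≤⟨ ∑-mono X (λ x → 𝟙-∷ x p Z) ⟩
  ∑[ x ∈ X ] (𝟙[ x ∈ [ p ] ] + 𝟙[ x ∈ Z ]) ≡⟨ ∑-+ X _ _ ⟩
  ∣ X ∩ [ p ] ∣ + ∣ X ∩ Z ∣                 ≤⟨ +-mono-≤ (∩-singleton unique p) (∩≤length unique Z) ⟩
  suc (length Z)                            ∎
  where open ≤-Reasoning

m+n≤3⇒m*n≤2 : ∀ m n → m + n ≤ 3 → m * n ≤ 2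
m+n≤3⇒m*n≤2 0 n _     = z≤n
m+n≤3⇒m*n≤2 1 n 1+n≤3 = subst (_≤ 2) (sym (+-identityʳ n)) (≤-pred 1+n≤3)
m+n≤3⇒m*n≤2 2 0 _     = z≤n
m+n≤3⇒m*n≤2 2 1 _     = ≤-refl
m+n≤3⇒m*n≤2 2 (suc (suc n)) (s≤s (s≤s (s≤s ())))
m+n≤3⇒m*n≤2 3 0 _     = z≤n
m+n≤3⇒m*n≤2 3 (suc n) (s≤s (s≤s (s≤s ())))
m+n≤3⇒m*n≤2 (suc (suc (suc (suc m)))) n (s≤s (s≤s (s≤s ())))

Separated : List (List ℕ) → ℕ → ℕ → Set
Separated Zs x y = All (λ Z → ¬ (x ∈ Z × y ∈ Z)) Zs

separated? : ∀ Zs x y → Dec (Separated Zs x y)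
separated? Zs x y = all? (λ Z → ¬? (x ∈? Z ×-dec y ∈? Z)) Zs

pairs-in : List (List ℕ) → ℕ → ℕ → ℕ
pairs-in Zs x y = ∑[ Z ∈ Zs ] (𝟙[ x ∈ Z ] * 𝟙[ y ∈ Z ])

∑pairs-in≡∑∩* : ∀ X Y Zs →
  ∑[ x ∈ X ] ∑[ y ∈ Y ] pairs-in Zs x y ≡ ∑[ Z ∈ Zs ] (∣ X ∩ Z ∣ * ∣ Y ∩ Z ∣)
∑pairs-in≡∑∩* X Y Zs = begin
  ∑[ x ∈ X ] ∑[ y ∈ Y ] ∑[ Z ∈ Zs ] (𝟙[ x ∈ Z ] * 𝟙[ y ∈ Z ])
    ≡⟨ ∑-cong X (λ x → ∑-comm Y Zs _) ⟩
  ∑[ x ∈ X ] ∑[ Z ∈ Zs ] ∑[ y ∈ Y ] (𝟙[ x ∈ Z ] * 𝟙[ y ∈ Z ])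
    ≡⟨ ∑-comm X Zs _ ⟩
  ∑[ Z ∈ Zs ] ∑[ x ∈ X ] ∑[ y ∈ Y ] (𝟙[ x ∈ Z ] * 𝟙[ y ∈ Z ])
    ≡⟨ ∑-cong Zs (λ Z → ∑-cong X λ x → ∑-*ˡ Y 𝟙[ x ∈ Z ] _) ⟩
  ∑[ Z ∈ Zs ] ∑[ x ∈ X ] (𝟙[ x ∈ Z ] * ∣ Y ∩ Z ∣)
    ≡⟨ ∑-cong Zs (λ Z → ∑-*ʳ X ∣ Y ∩ Z ∣ _) ⟩
  ∑[ Z ∈ Zs ] (∣ X ∩ Z ∣ * ∣ Y ∩ Z ∣)
    ∎
  where open ≡-Reasoning

¬separated⇒1≤pairs-in : ¬ Separated Zs x y → 1 ≤ pairs-in Zs x y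
¬separated⇒1≤pairs-in {Zs} {x} {y} ¬separated = common⇒1≤ (Any.map
  (λ {Z} → decidable-stable (x ∈? Z ×-dec y ∈? Z))
  (¬All⇒Any¬ (λ Z → ¬? (x ∈? Z ×-dec y ∈? Z)) Zs ¬separated))
  where
  common⇒1≤ : ∀ {Zs} → Any (λ Z → x ∈ Z × y ∈ Z) Zs → 1 ≤ pairs-in Zs x y
  common⇒1≤ (here (x∈Z , y∈Z)) =
    ≤-trans (≤-reflexive (sym (cong₂ _*_ (𝟙-∈ x∈Z) (𝟙-∈ y∈Z)))) (m≤m+n _ _)
  common⇒1≤ (there common) = ≤-trans (common⇒1≤ common) (m≤n+m _ _)

-- A list Z of at most three colours contains at most |X ∩ Z| |Y ∩ Z| ≤ 2 of the
-- pairs in X × Y, so fewer than |X| |Y| / 2 such lists cannot contain them all.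
uncovered-pair : ∀ X Y Zs → Unique (X ++ Y) →
  All (λ Z → length Z ≤ 3) Zs → 2 * length Zs < length X * length Y →
  ∃₂ λ x y → x ∈ X × y ∈ Y × Separated Zs x y
uncovered-pair X Y Zs unique short few with any? (λ x → any? (separated? Zs x) Y) X
... | yes some = let x , x∈X , some-y       = find some
                     y , y∈Y , separated-xy = find some-y
                 in x , y , x∈X , y∈Y , separated-xy
... | no none  = ⊥-elim (<⇒≱ few (begin
  length X * length Y                    ≡⟨ cong (length X *_) (sym (*-identityʳ _)) ⟩
  length X * (length Y * 1)              ≤⟨ ∑-≥ (All.map (∑-≥ ∘ All.map ¬separated⇒1≤pairs-in) none-separated) ⟩
  ∑[ x ∈ X ] ∑[ y ∈ Y ] pairs-in Zs x y  ≡⟨ ∑pairs-in≡∑∩* X Y Zs ⟩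
  ∑[ Z ∈ Zs ] (∣ X ∩ Z ∣ * ∣ Y ∩ Z ∣)    ≤⟨ ∑-≤ (All.map at-most-two short) ⟩
  length Zs * 2                          ≡⟨ *-comm (length Zs) 2 ⟩
  2 * length Zs                          ∎))
  where
  open ≤-Reasoning
  none-separated : All (λ x → All (λ y → ¬ Separated Zs x y) Y) X
  none-separated = All.map (¬Any⇒All¬ Y) (¬Any⇒All¬ X none)
  at-most-two : ∀ {Z} → length Z ≤ 3 → ∣ X ∩ Z ∣ * ∣ Y ∩ Z ∣ ≤ 2
  at-most-two {Z} |Z|≤3 = m+n≤3⇒m*n≤2 ∣ X ∩ Z ∣ ∣ Y ∩ Z ∣
    (≤-trans (≤-reflexive (sym (∩-++ X Y Z))) (≤-trans (∩≤length unique Z) |Z|≤3))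

-- The graph G_{l,m,1} on natural-number indices

atℕ : ∀ {n} → (Fin n → A) → A → ℕ → A
atℕ {n = n} f d k with k <? n
... | yes k<n = f (fromℕ< k<n)
... | no _    = d

module _ {n} (f : Fin n → A) (d : A) where

  atℕ-fromℕ< : ∀ {k} (k<n : k < n) → atℕ f d k ≡ f (fromℕ< k<n)
  atℕ-fromℕ< {k} k<n with k <? n
  ... | yes _  = refl
  ... | no k≮n = ⊥-elim (k≮n k<n)

  atℕ-toℕ : ∀ x → atℕ f d (toℕ x) ≡ f x
  atℕ-toℕ x = trans (atℕ-fromℕ< (toℕ<n x)) (cong f (fromℕ<-toℕ x _))

module Layout (l m : ℕ) where

  G : Graph
  G = G-lm1 l m

  N u s : ℕ
  N = 2 * l
  u = 2 * l + 1
  s = 2 * l + 2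

  u≡1+N : u ≡ suc N
  u≡1+N = +-comm N 1

  s≡1+u : s ≡ suc u
  s≡1+u = +-suc N 1

  N<u : N < u
  N<u = ≤-reflexive (sym u≡1+N)

  u<s : u < s
  u<s = ≤-reflexive (sym s≡1+u)

  s<size : s < size G
  s<size = ≤-reflexive (sym (+-suc N 2))

  <size⇒≤s : ∀ {k} → k < size G → k ≤ s
  <size⇒≤s {k} k<size = ≤-pred (subst (k <_) (+-suc N 2) k<size)

  <u⇒≤N : ∀ {i} → i < u → i ≤ N
  <u⇒≤N {i} i<u = ≤-pred (subst (i <_) u≡1+N i<u)

  ≤N⇒<u : ∀ {i} → i ≤ N → i < u
  ≤N⇒<u i≤N = ≤-trans (s≤s i≤N) N<u

  ≤N⇒≤s : ∀ {i} → i ≤ N → i ≤ s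
  ≤N⇒≤s i≤N = <⇒≤ (<-trans (≤N⇒<u i≤N) u<s)

  <u⇒<size : ∀ {i} → i < u → i < size G
  <u⇒<size i<u = <-trans i<u (<-trans u<s s<size)

  vertex-cases : ∀ {k} → k ≤ s → k ≤ N ⊎ k ≡ u ⊎ k ≡ s
  vertex-cases {k} k≤s with k ≤? N | k ≟ u
  ... | yes k≤N | _       = inj₁ k≤N
  ... | no _    | yes k≡u = inj₂ (inj₁ k≡u)
  ... | no k≰N  | no k≢u  =
    inj₂ (inj₂ (≤-antisym k≤s (subst (_≤ k) (sym s≡1+u) (≤∧≢⇒< u≤k (k≢u ∘ sym)))))
    where u≤k = subst (_≤ k) (sym u≡1+N) (≰⇒> k≰N)

  edge-bounds : ∀ {a b} → Edge l m a b → a < size G × b < size G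
  edge-bounds (cyc 1+i<u)  = <u⇒<size (<-trans (n<1+n _) 1+i<u) , <u⇒<size 1+i<u
  edge-bounds close        = <u⇒<size (≤N⇒<u z≤n) , <u⇒<size N<u
  edge-bounds (uEdge _ j<u) = <-trans u<s s<size , <u⇒<size j<u
  edge-bounds (sEdge _ j<u) = s<size , <u⇒<size j<u

  respects-edges⇒proper : (col : ℕ → A) → (∀ {a b} → Edge l m a b → col a ≢ col b) →
    ∀ x y → Adj G x y → col (toℕ x) ≢ col (toℕ y)
  respects-edges⇒proper col respects x y (inj₁ e) = respects e
  respects-edges⇒proper col respects x y (inj₂ e) = respects e ∘ sym

  proper⇒respects-edges : (f : Fin (size G) → A) (d : A) →
    (∀ x y → Adj G x y → f x ≢ f y) → ∀ {a b} → Edge l m a b → atℕ f d a ≢ atℕ f d b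
  proper⇒respects-edges f d proper e =
    ≢-transport (atℕ-fromℕ< f d a<size) (atℕ-fromℕ< f d b<size)
      (proper (fromℕ< a<size) (fromℕ< b<size)
        (inj₁ (subst₂ (Edge l m) (sym (toℕ-fromℕ< a<size)) (sym (toℕ-fromℕ< b<size)) e)))
    where
    a<size = proj₁ (edge-bounds e)
    b<size = proj₂ (edge-bounds e)

  with-hubs : (ℕ → A) → A → A → ℕ → A
  with-hubs g cu cs = splice N g (splice u (λ _ → cu) (λ _ → cs))

  module _ (g : ℕ → A) (cu cs : A) where

    private
      hubs : ℕ → A
      hubs = splice u (λ _ → cu) (λ _ → cs)

    with-hubs-cycle : ∀ {i} → i ≤ N → with-hubs g cu cs i ≡ g i
    with-hubs-cycle = splice-≤ g hubs

    with-hubs-u : with-hubs g cu cs u ≡ cu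
    with-hubs-u = trans (splice-> g hubs N<u) (splice-≤ {j = u} (λ _ → cu) (λ _ → cs) ≤-refl)

    with-hubs-s : with-hubs g cu cs s ≡ cs
    with-hubs-s = trans (splice-> g hubs (<-trans N<u u<s)) (splice-> (λ _ → cu) (λ _ → cs) u<s)

    with-hubs-elim : (R : ℕ → A → Set) → (∀ {i} → i ≤ N → R i (g i)) → R u cu → R s cs →
      ∀ {k} → k ≤ s → R k (with-hubs g cu cs k)
    with-hubs-elim R cycle Ru Rs k≤s with vertex-cases k≤s
    ... | inj₁ k≤N         = subst (R _) (sym (with-hubs-cycle k≤N)) (cycle k≤N)
    ... | inj₂ (inj₁ refl) = subst (R u) (sym with-hubs-u) Ru
    ... | inj₂ (inj₂ refl) = subst (R s) (sym with-hubs-s) Rs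

    with-hubs-respects-edges :
      (∀ {i} → i < N → g i ≢ g (suc i)) → g 0 ≢ g N →
      (∀ {j} → j ≤ N → j < m + 2 → g j ≢ cu) → (∀ {j} → j ≤ N → 2 ≤ j → g j ≢ cs) →
      ∀ {a b} → Edge l m a b → with-hubs g cu cs a ≢ with-hubs g cu cs b
    with-hubs-respects-edges path closing sees-u sees-s (cyc 1+i<u) =
      ≢-transport (with-hubs-cycle (<⇒≤ (<u⇒≤N 1+i<u))) (with-hubs-cycle (<u⇒≤N 1+i<u))
        (path (<u⇒≤N 1+i<u))
    with-hubs-respects-edges path closing sees-u sees-s close =
      ≢-transport (with-hubs-cycle z≤n) (with-hubs-cycle ≤-refl) closing
    with-hubs-respects-edges path closing sees-u sees-s (uEdge j<m+2 j<u) =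
      ≢-transport with-hubs-u (with-hubs-cycle (<u⇒≤N j<u)) (sees-u (<u⇒≤N j<u) j<m+2 ∘ sym)
    with-hubs-respects-edges path closing sees-u sees-s (sEdge 2≤j j<u) =
      ≢-transport with-hubs-s (with-hubs-cycle (<u⇒≤N j<u)) (sees-s (<u⇒≤N j<u) 2≤j ∘ sym)

-- The chromatic number

unique⇒length≤ : ∀ {j n} (xs : Vec (Fin j) n) → UniqueVec xs → n ≤ j
unique⇒length≤ {j} {n} xs unique with n ≤? j
... | yes n≤j = n≤j
... | no n≰j with pigeonhole (≰⇒> n≰j) (lookup xs)
...   | i , k , i<k , xs[i]≡xs[k] =
  ⊥-elim (<-irrefl (cong toℕ (lookup-injective unique i k xs[i]≡xs[k])) i<k)

alternating : ℕ → Fin 4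
alternating zero          = sucF 0F
alternating (suc zero)    = sucF (sucF 0F)
alternating (suc (suc i)) = alternating i

alternating-proper : ∀ i → alternating i ≢ alternating (suc i)
alternating-proper zero          ()
alternating-proper (suc zero)    ()
alternating-proper (suc (suc i)) = alternating-proper i

alternating≢0 : ∀ i → alternating i ≢ 0F
alternating≢0 zero          ()
alternating≢0 (suc zero)    ()
alternating≢0 (suc (suc i)) = alternating≢0 i

alternating≢3 : ∀ i → alternating i ≢ sucF (sucF (sucF 0F))
alternating≢3 zero          ()
alternating≢3 (suc zero)    ()
alternating≢3 (suc (suc i)) = alternating≢3 i

-- v₁ gets 0 and the rest of C alternates 1, 2; u gets 3 and s, which misses v₁, gets 0.
four-colouring : ∀ l m → 1 ≤ l → Colorable (G-lm1 l m) 4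
four-colouring l m 1≤l =
  col ∘ toℕ ,
  respects-edges⇒proper col (with-hubs-respects-edges cycle-colour u-colour s-colour
    cycle-proper closing (λ {j} _ _ → cycle≢3 j) (λ _ 2≤j → cycle≢0 (≤-trans (s≤s z≤n) 2≤j)))
  where
  open Layout l m
  cycle-colour : ℕ → Fin 4
  cycle-colour zero    = 0F
  cycle-colour (suc i) = alternating i
  u-colour s-colour : Fin 4
  u-colour = sucF (sucF (sucF 0F))
  s-colour = 0F
  col = with-hubs cycle-colour u-colour s-colour
  cycle≢0 : ∀ {j} → 1 ≤ j → cycle-colour j ≢ s-colour
  cycle≢0 {suc j} _ = alternating≢0 j
  cycle≢3 : ∀ j → cycle-colour j ≢ u-colour
  cycle≢3 zero    ()
  cycle≢3 (suc j) = alternating≢3 j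
  cycle-proper : ∀ {i} → i < N → cycle-colour i ≢ cycle-colour (suc i)
  cycle-proper {zero}  _ = cycle≢0 {1} (s≤s z≤n) ∘ sym
  cycle-proper {suc i} _ = alternating-proper i
  closing : cycle-colour 0 ≢ cycle-colour N
  closing = cycle≢0 (≤-trans (s≤s z≤n) (*-monoʳ-≤ 2 1≤l)) ∘ sym

module NoThreeColouring (l m : ℕ) (2≤l : 2 ≤ l) (1≤m : 1 ≤ m) {j : ℕ} (j≤3 : j ≤ 3)
  (f : Fin (size (G-lm1 l m)) → Fin j) (f-proper : ∀ x y → Adj (G-lm1 l m) x y → f x ≢ f y) where

  open Layout l m

  col : ℕ → Fin j
  col = atℕ f (f (fromℕ< s<size))

  edge : ∀ {a b} → Edge l m a b → col a ≢ col b
  edge = proper⇒respects-edges f _ f-proper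

  four-colours : ∀ {a b c d : Fin j} → a ≢ b → a ≢ c → a ≢ d → b ≢ c → b ≢ d → c ≢ d → ⊥
  four-colours a≢b a≢c a≢d b≢c b≢d c≢d = <⇒≱ (s≤s j≤3) (unique⇒length≤ (_ ∷ _ ∷ _ ∷ _ ∷ [])
    ((a≢b ∷ a≢c ∷ a≢d ∷ []) ∷ (b≢c ∷ b≢d ∷ []) ∷ (c≢d ∷ []) ∷ [] ∷ []))

  3≤N : 3 ≤ N
  3≤N = ≤-trans (n≤1+n 3) (*-monoʳ-≤ 2 2≤l)

  2≤N : 2 ≤ N
  2≤N = ≤-trans (n≤1+n 2) 3≤N

  1≤N : 1 ≤ N
  1≤N = ≤-trans (n≤1+n 1) 2≤N

  cycle-edge : ∀ {i} → i < N → col i ≢ col (suc i)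
  cycle-edge i<N = edge (cyc (≤N⇒<u i<N))

  σ : Fin j
  σ = col s

  s-edge : ∀ {k} → 2 ≤ k → k ≤ N → col k ≢ σ
  s-edge 2≤k k≤N = edge (sEdge 2≤k (≤N⇒<u k≤N)) ∘ sym

  u-avoids : ∀ {k c} → k ≤ 2 → col k ≡ c → col u ≢ c
  u-avoids k≤2 col-k≡c eq =
    edge (uEdge (≤-trans (s≤s k≤2) (+-monoˡ-≤ 2 1≤m)) (≤N⇒<u (≤-trans k≤2 2≤N)))
      (trans eq (sym col-k≡c))

  period-two : ∀ {k} → 2 ≤ k → 2 + k ≤ N → col k ≡ col (2 + k)
  period-two {k} 2≤k 2+k≤N with col k ≟F col (2 + k)
  ... | yes k≡2+k = k≡2+k
  ... | no k≢2+k  = ⊥-elim (four-colours (cycle-edge k<N) k≢2+k (s-edge 2≤k (<⇒≤ k<N))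
          (cycle-edge 2+k≤N) (s-edge (≤-trans 2≤k (n≤1+n k)) k<N) (s-edge (≤-trans 2≤k (m≤n+m k 2)) 2+k≤N))
    where
    k<N : k < N
    k<N = ≤-trans (n≤1+n _) 2+k≤N

  col-2≡col-N : col 2 ≡ col N
  col-2≡col-N = subst (λ k → col 2 ≡ col k) (sym N≡2+2t) (even-vertex (l ∸ 1) (≤-reflexive (sym N≡2+2t)))
    where
    N≡2+2t : N ≡ 2 + 2 * (l ∸ 1)
    N≡2+2t = trans (cong (2 *_) (sym (m+[n∸m]≡n (≤-trans (s≤s z≤n) 2≤l)))) (*-suc 2 (l ∸ 1))
    even-vertex : ∀ t → 2 + 2 * t ≤ N → col 2 ≡ col (2 + 2 * t)
    even-vertex zero    _          = refl
    even-vertex (suc t) 2+2[1+t]≤N =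
      trans (even-vertex t (m+n≤o⇒n≤o 2 bound)) (trans (period-two (m≤m+n 2 _) bound) (cong col (sym step)))
      where
      step : 2 + 2 * suc t ≡ 2 + (2 + 2 * t)
      step = cong (2 +_) (*-suc 2 t)
      bound : 2 + (2 + 2 * t) ≤ N
      bound = subst (_≤ N) step 2+2[1+t]≤N

  α β : Fin j
  α = col 2
  β = col 3

  σ-or-β : ∀ {c} → c ≢ α → c ≡ σ ⊎ c ≡ β
  σ-or-β {c} c≢α with c ≟F σ | c ≟F β
  ... | yes c≡σ | _       = inj₁ c≡σ
  ... | no _    | yes c≡β = inj₂ c≡β
  ... | no c≢σ  | no c≢β  = ⊥-elim (four-colours c≢σ c≢α c≢β
          (s-edge ≤-refl 2≤N ∘ sym) (s-edge (n≤1+n 2) 3≤N ∘ sym) (cycle-edge 3≤N))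

  impossible : ⊥
  impossible with σ-or-β {col 0} (λ eq → edge close (trans eq col-2≡col-N))
                | σ-or-β {col 1} (cycle-edge 2≤N)
                | σ-or-β {col u} (u-avoids ≤-refl refl)
  ... | inj₁ c₀≡σ | inj₁ c₁≡σ | _        = cycle-edge 1≤N (trans c₀≡σ (sym c₁≡σ))
  ... | inj₂ c₀≡β | inj₂ c₁≡β | _        = cycle-edge 1≤N (trans c₀≡β (sym c₁≡β))
  ... | inj₁ c₀≡σ | inj₂ c₁≡β | u-colour = [ u-avoids z≤n c₀≡σ , u-avoids (n≤1+n 1) c₁≡β ]′ u-colour
  ... | inj₂ c₀≡β | inj₁ c₁≡σ | u-colour = [ u-avoids (n≤1+n 1) c₁≡σ , u-avoids z≤n c₀≡β ]′ u-colour

chromatic-number-4 : ∀ l m → 2 ≤ l → 1 ≤ m → ChromaticNumberIs (G-lm1 l m) 4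
chromatic-number-4 l m 2≤l 1≤m = four-colouring l m (≤-trans (s≤s z≤n) 2≤l) , at-least-four
  where
  at-least-four : ∀ j → Colorable (G-lm1 l m) j → 4 ≤ j
  at-least-four j (f , f-proper) with 4 ≤? j
  ... | yes 4≤j = 4≤j
  ... | no 4≰j  = ⊥-elim (NoThreeColouring.impossible l m 2≤l 1≤m (≤-pred (≰⇒> 4≰j)) f f-proper)

-- Strong choosability

module StrongChoosability (l m : ℕ) (2≤l : 2 ≤ l) (m≤2l-2 : m ≤ 2 * l ∸ 2) (m≤4 : m ≤ 4)
  (L : ListAssignment (G-lm1 l m)) (L-three : IsKAssignment (G-lm1 l m) 3 L)
  (uncolourable : ¬ LColorable (G-lm1 l m) L) where

  open Layout l m

  L′ : ℕ → List ℕ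
  L′ = atℕ L []

  L′-triple : ∀ {k} → k ≤ s → Unique (L′ k) × length (L′ k) ≡ 3
  L′-triple k≤s = subst (λ Z → Unique Z × length Z ≡ 3) (sym (atℕ-fromℕ< L [] k<size)) (L-three _)
    where k<size = ≤-trans (s≤s k≤s) s<size

  L′-three : ∀ {k} → k ≤ s → AtLeastThree (_∈ L′ k)
  L′-three k≤s = triple⇒three (proj₁ (L′-triple k≤s)) (proj₂ (L′-triple k≤s))

  L′-short : ∀ k → length (L′ k) ≤ 3
  L′-short k with k <? size G
  ... | yes k<size = ≤-reflexive (proj₂ (L-three (fromℕ< k<size)))
  ... | no _       = z≤n

  2≤N : 2 ≤ N
  2≤N = *-monoʳ-≤ 2 (≤-trans (s≤s z≤n) 2≤l)

  1≤N : 1 ≤ N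
  1≤N = ≤-trans (n≤1+n 1) 2≤N

  m+2≤N : m + 2 ≤ N
  m+2≤N = ≤-trans (+-monoˡ-≤ 2 m≤2l-2) (≤-reflexive (m∸n+n≡m 2≤N))

  -- The colours left at cycle vertex i once u and s are coloured cu and cs
  -- (i < m + 2 says i is adjacent to u, and 2 ≤ i that it is adjacent to s).
  Admissible : ℕ → ℕ → ℕ → ℕ → Set
  Admissible cu cs i x = x ∈ L′ i × (i < m + 2 → x ≢ cu) × (2 ≤ i → x ≢ cs)

  admissible-at-1 : ∀ {cu cs x} → x ∈ L′ 1 → x ≢ cu → Admissible cu cs 1 x
  admissible-at-1 x∈L′1 x≢cu = x∈L′1 , (λ _ → x≢cu) , λ { (s≤s ()) }

  admissible-at-N : ∀ {cu cs x} → x ∈ L′ N → x ≢ cs → Admissible cu cs N x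
  admissible-at-N x∈L′N x≢cs = x∈L′N , (λ N<m+2 → ⊥-elim (<⇒≱ N<m+2 m+2≤N)) , λ _ → x≢cs

  two-admissible : ∀ {cu cs i} → i ≤ N → ∀ c →
    (∀ {x} → x ∈ L′ i → x ≢ c → Admissible cu cs i x) → AtLeastTwo (Admissible cu cs i)
  two-admissible i≤N c avoiding = AtLeastTwo-map (λ (x∈ , x≢c) → avoiding x∈ x≢c)
    (three⇒two-avoiding (L′-three (≤N⇒≤s i≤N)) c)

  cycle⇒L-colouring : ∀ {cu cs} → cu ∈ L′ u → cs ∈ L′ s →
    CycleColouring (Admissible cu cs) N → LColorable G L
  cycle⇒L-colouring {cu} {cs} cu∈ cs∈ (h , closing) =
    col ∘ toℕ , in-lists ,
    respects-edges⇒proper col (with-hubs-respects-edges (colour h) cu cs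
      (proper h z≤n) closing
      (λ j≤N → proj₁ (proj₂ (admissible h z≤n j≤N)))
      (λ j≤N → proj₂ (proj₂ (admissible h z≤n j≤N))))
    where
    col = with-hubs (colour h) cu cs
    in-lists : ∀ x → col (toℕ x) ∈ L x
    in-lists x = subst (col (toℕ x) ∈_) (atℕ-toℕ L [] x)
      (with-hubs-elim (colour h) cu cs (λ k c → c ∈ L′ k) (proj₁ ∘ admissible h z≤n) cu∈ cs∈
        (<size⇒≤s (toℕ<n x)))

  no-three-admissible : ∀ {cu cs} → cu ∈ L′ u → cs ∈ L′ s →
    (∀ {i} → i ≤ N → AtLeastTwo (Admissible cu cs i)) →
    ∀ {i} → i ≤ N → ¬ AtLeastThree (Admissible cu cs i)
  no-three-admissible cu∈ cs∈ two =
    UncolourableCycle.no-three 1≤N two (uncolourable ∘ cycle⇒L-colouring cu∈ cs∈)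

  module Hubs {cu cs} (cu∈ : cu ∈ L′ u) (cs∈ : cs ∈ L′ s)
    (two : ∀ {i} → i ≤ N → AtLeastTwo (Admissible cu cs i)) where

    open UncolourableCycle 1≤N two (uncolourable ∘ cycle⇒L-colouring cu∈ cs∈) public

    b₁≢cu : b₁ ≢ cu
    b₁≢cu = proj₁ (proj₂ (b₁-admissible 1≤N)) (m≤n+m 2 m)

    b₂≢cu : b₂ ≢ cu
    b₂≢cu = proj₁ (proj₂ (b₂-admissible 1≤N)) (m≤n+m 2 m)

    b₁≢cs : b₁ ≢ cs
    b₁≢cs = proj₂ (proj₂ (b₁-admissible ≤-refl)) 2≤N

    b₂≢cs : b₂ ≢ cs
    b₂≢cs = proj₂ (proj₂ (b₂-admissible ≤-refl)) 2≤N

    recoloured-two : ∀ {cu′ cs′} → b₁ ≢ cu′ → b₁ ≢ cs′ → b₂ ≢ cu′ → b₂ ≢ cs′ →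
      ∀ {i} → i ≤ N → AtLeastTwo (Admissible cu′ cs′ i)
    recoloured-two b₁≢cu′ b₁≢cs′ b₂≢cu′ b₂≢cs′ i≤N =
      b₁ , b₂ , b₁≢b₂ ,
      (proj₁ (b₁-admissible i≤N) , (λ _ → b₁≢cu′) , λ _ → b₁≢cs′) ,
      (proj₁ (b₂-admissible i≤N) , (λ _ → b₂≢cu′) , λ _ → b₂≢cs′)

    cu∈L′1 : cu ∈ L′ 1
    cu∈L′1 with cu ∈? L′ 1
    ... | yes cu∈L′1 = cu∈L′1
    ... | no cu∉L′1  = ⊥-elim (no-three 1≤N (AtLeastThree-map
          (λ x∈ → admissible-at-1 x∈ λ { refl → cu∉L′1 x∈ }) (L′-three (≤N⇒≤s 1≤N))))

    cs∈L′N : cs ∈ L′ N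
    cs∈L′N with cs ∈? L′ N
    ... | yes cs∈L′N = cs∈L′N
    ... | no cs∉L′N  = ⊥-elim (no-three ≤-refl (AtLeastThree-map
          (λ x∈ → admissible-at-N x∈ λ { refl → cs∉L′N x∈ }) (L′-three (≤N⇒≤s ≤-refl))))

    -- Recolouring u by another colour x of its list keeps b₁ and b₂ admissible
    -- everywhere and makes cu, b₁, b₂ all admissible at vertex 1.
    L′u-within : ∀ {x} → x ∈ L′ u → x ≡ cu ⊎ x ≡ b₁ ⊎ x ≡ b₂
    L′u-within {x} x∈ with x ≟ cu | x ≟ b₁ | x ≟ b₂
    ... | yes x≡cu | _        | _        = inj₁ x≡cu
    ... | no _     | yes x≡b₁ | _        = inj₂ (inj₁ x≡b₁)
    ... | no _     | no _     | yes x≡b₂ = inj₂ (inj₂ x≡b₂)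
    ... | no x≢cu  | no x≢b₁  | no x≢b₂  = ⊥-elim (no-three-admissible x∈ cs∈
          (recoloured-two (x≢b₁ ∘ sym) b₁≢cs (x≢b₂ ∘ sym) b₂≢cs) 1≤N
          (cu , b₁ , b₂ , b₁≢cu ∘ sym , b₂≢cu ∘ sym , b₁≢b₂ ,
           admissible-at-1 cu∈L′1 (x≢cu ∘ sym) ,
           admissible-at-1 (proj₁ (b₁-admissible 1≤N)) (x≢b₁ ∘ sym) ,
           admissible-at-1 (proj₁ (b₂-admissible 1≤N)) (x≢b₂ ∘ sym)))

    L′s-within : ∀ {y} → y ∈ L′ s → y ≡ cs ⊎ y ≡ b₁ ⊎ y ≡ b₂
    L′s-within {y} y∈ with y ≟ cs | y ≟ b₁ | y ≟ b₂
    ... | yes y≡cs | _        | _        = inj₁ y≡cs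
    ... | no _     | yes y≡b₁ | _        = inj₂ (inj₁ y≡b₁)
    ... | no _     | no _     | yes y≡b₂ = inj₂ (inj₂ y≡b₂)
    ... | no y≢cs  | no y≢b₁  | no y≢b₂  = ⊥-elim (no-three-admissible cu∈ y∈
          (recoloured-two b₁≢cu (y≢b₁ ∘ sym) b₂≢cu (y≢b₂ ∘ sym)) ≤-refl
          (cs , b₁ , b₂ , b₁≢cs ∘ sym , b₂≢cs ∘ sym , b₁≢b₂ ,
           admissible-at-N cs∈L′N (y≢cs ∘ sym) ,
           admissible-at-N (proj₁ (b₁-admissible ≤-refl)) (y≢b₁ ∘ sym) ,
           admissible-at-N (proj₁ (b₂-admissible ≤-refl)) (y≢b₂ ∘ sym)))

  shared-hub-colour⇒constant : ∀ {a} → a ∈ L′ u → a ∈ L′ s → IsConstant G L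
  shared-hub-colour⇒constant {a} a∈L′u a∈L′s x y c c∈Lx =
    subst (c ∈_) (atℕ-toℕ L [] y)
      (in-every-list (<size⇒≤s (toℕ<n x)) (<size⇒≤s (toℕ<n y)) (subst (c ∈_) (sym (atℕ-toℕ L [] x)) c∈Lx))
    where
    open Hubs a∈L′u a∈L′s (λ i≤N → two-admissible i≤N a λ x∈ x≢a → x∈ , (λ _ → x≢a) , λ _ → x≢a)
    within : ∀ {k} → k ≤ s → ∀ {x} → x ∈ L′ k → x ≡ a ⊎ x ≡ b₁ ⊎ x ≡ b₂
    within k≤s {x} x∈ with vertex-cases k≤s | x ≟ a
    ... | inj₁ _           | yes x≡a = inj₁ x≡a
    ... | inj₁ k≤N         | no x≢a  = inj₂ (admissible⇒b₁∨b₂ k≤N (x∈ , (λ _ → x≢a) , λ _ → x≢a))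
    ... | inj₂ (inj₁ refl) | _       = L′u-within x∈
    ... | inj₂ (inj₂ refl) | _       = L′s-within x∈
    in-every-list : ∀ {k k′ c} → k ≤ s → k′ ≤ s → c ∈ L′ k → c ∈ L′ k′
    in-every-list k≤s k′≤s c∈ with within k≤s c∈ | within-triple⇒all∈ (L′-three k′≤s) (within k′≤s)
    ... | inj₁ refl        | a∈ , _      = a∈
    ... | inj₂ (inj₁ refl) | _ , b₁∈ , _ = b₁∈
    ... | inj₂ (inj₂ refl) | _ , _ , b₂∈ = b₂∈

  common-neighbour-lists : List (List ℕ)
  common-neighbour-lists = map (λ k → L′ (2 + k)) (upTo m)

  few-common-neighbours : 2 * length common-neighbour-lists < length (L′ u) * length (L′ s)
  few-common-neighbours
    rewrite length-map (λ k → L′ (2 + k)) (upTo m) | length-upTo m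
          | proj₂ (L′-triple (<⇒≤ u<s)) | proj₂ (L′-triple ≤-refl) = s≤s (*-monoʳ-≤ 2 m≤4)

  disjoint-hub-lists : ¬ Disjoint (L′ u) (L′ s)
  disjoint-hub-lists disjoint
    with uncovered-pair (L′ u) (L′ s) common-neighbour-lists
           (++⁺ (proj₁ (L′-triple (<⇒≤ u<s))) (proj₁ (L′-triple ≤-refl)) disjoint)
           (All-map⁺ (All.universal (λ k → L′-short (2 + k)) (upTo m))) few-common-neighbours
  ... | x , y , x∈L′u , y∈L′s , separated =
    disjoint (proj₁ (proj₂ (within-triple⇒all∈ (L′-three (<⇒≤ u<s)) L′u-within)) ,
              proj₁ (proj₂ (within-triple⇒all∈ (L′-three ≤-refl) L′s-within)))
    where
    apart : ∀ {i} → 2 ≤ i → i < m + 2 → x ∈ L′ i → y ∈ L′ i → ⊥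
    apart {i} 2≤i i<m+2 x∈ y∈ =
      All.lookup separated (∈-map⁺ (λ k → L′ (2 + k)) (∈-upTo⁺ i∸2<m))
        (subst (x ∈_) L′i≡ x∈ , subst (y ∈_) L′i≡ y∈)
      where
      L′i≡ : L′ i ≡ L′ (2 + (i ∸ 2))
      L′i≡ = cong L′ (sym (m+[n∸m]≡n 2≤i))
      i∸2<m : i ∸ 2 < m
      i∸2<m = subst (i ∸ 2 <_) (m+n∸n≡m m 2) (∸-monoˡ-< i<m+2 2≤i)
    two : ∀ {i} → i ≤ N → AtLeastTwo (Admissible x y i)
    two {i} i≤N with i <? m + 2
    ... | no i≮m+2 = two-admissible i≤N y λ z∈ z≢y →
          z∈ , (λ i<m+2 → ⊥-elim (i≮m+2 i<m+2)) , λ _ → z≢y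
    ... | yes i<m+2 with x ∈? L′ i
    ...   | yes x∈L′i = two-admissible i≤N x λ z∈ z≢x →
            z∈ , (λ _ → z≢x) , λ 2≤i → λ { refl → apart 2≤i i<m+2 x∈L′i z∈ }
    ...   | no x∉L′i  = two-admissible i≤N y λ z∈ z≢y →
            z∈ , (λ _ → λ { refl → x∉L′i z∈ }) , λ _ → z≢y
    open Hubs x∈L′u y∈L′s two

  L-constant : IsConstant G L
  L-constant with any? (_∈? L′ s) (L′ u)
  ... | yes shared = let a , a∈L′u , a∈L′s = find shared in shared-hub-colour⇒constant a∈L′u a∈L′s
  ... | no ¬shared = ⊥-elim (disjoint-hub-lists λ (a∈L′u , a∈L′s) →
                       All.lookup (¬Any⇒All¬ _ ¬shared) a∈L′u a∈L′s)

proposition2p3 : (l m : ℕ) → 2 ≤ l → 1 ≤ m → m ≤ 2 * l ∸ 2 → m ≤ 4 →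
    StrongChromaticChoosable (G-lm1 l m) 4
proposition2p3 l m 2≤l 1≤m m≤2l-2 m≤4 =
  chromatic-number-4 l m 2≤l 1≤m ,
  λ L L-three uncolourable → StrongChoosability.L-constant l m 2≤l m≤2l-2 m≤4 L L-three uncolourable
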